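{- Let $m_1,m_2,m_3$ be positive integers and $s_{i,j}=\gcd(m_i,m_j)$ for $1\le i<j\le 3$. Then $\gcd(s_{1,2}^2m_3,\ s_{1,3}^2m_2,\ s_{2,3}^2m_1)=s_{1,2}s_{1,3}s_{2,3}$. -}

module Submission where

-- Write a = gcd m₁ m₂, b = gcd m₁ m₃, c = gcd m₂ m₃.  Both sides
-- of the identity are the gcd of the seven "mixed" cubic monomials
--   m₁²m₂, m₁²m₃, m₁m₂², m₁m₂m₃, m₁m₃², m₂²m₃, m₂m₃²
-- (all monomials of degree three in m₁, m₂, m₃ except the pure cubes).
-- Rather than computing with gcd-expressions we compare divisors: a natural
-- number d divides either side iff it divides all seven mixed monomials, and
-- two numbers with the same divisors are equal (antisymmetry of ∣).
--
-- The general tool is the divisor description of a product of gcds: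
--   d ∣ gcd x₁ y₁ * gcd x₂ y₂ * w  iff  d divides every product c₁ * c₂ * w
-- with cᵢ ∈ {xᵢ, yᵢ}, and likewise for three gcd factors.  It follows from
-- the distributivity  u * gcd x y ≡ gcd (u * x) (u * y)  together with the
-- fact that divisibility of a threefold product ignores the order of the
-- factors.  Applied to a²m₃, b²m₂, c²m₁ and to abc it yields the seven
-- monomials in both cases, and the theorem follows.

open import Data.Bool using (Bool; true; false; if_then_else_)
open import Data.Nat using (ℕ; _*_; _^_; NonZero)
open import Data.Nat.Divisibility using (_∣_; ∣-refl; ∣-trans; ∣-antisym; *-pres-∣; *-monoʳ-∣; *-monoˡ-∣)
open import Data.Nat.GCD using (gcd; gcd[m,n]∣m; gcd[m,n]∣n; gcd-greatest; c*gcd[m,n]≡gcd[cm,cn])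
open import Data.Nat.Properties using (*-identityʳ; *-commutativeSemigroup)
open import Data.Product using (_×_; _,_)
open import Relation.Binary.PropositionalEquality using (_≡_; cong; sym; subst)
open import Algebra.Properties.CommutativeSemigroup *-commutativeSemigroup using (xy∙z≈yx∙z; xy∙z≈xz∙y)

gcd∣choice : ∀ k x y → gcd x y ∣ (if k then x else y)
gcd∣choice true  x y = gcd[m,n]∣m x y
gcd∣choice false x y = gcd[m,n]∣n x y

square* : ∀ x z → x ^ 2 * z ≡ x * x * z
square* x z = cong (λ t → x * t * z) (*-identityʳ x)

module _ {d : ℕ} where

  ∣gcd⇒ : ∀ {m n} → d ∣ gcd m n → d ∣ m × d ∣ n
  ∣gcd⇒ {m} {n} h = ∣-trans h (gcd[m,n]∣m m n) , ∣-trans h (gcd[m,n]∣n m n)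

  ∣-swap₁₂ : ∀ x y z → d ∣ x * y * z → d ∣ y * x * z
  ∣-swap₁₂ x y z = subst (d ∣_) (xy∙z≈yx∙z x y z)

  ∣-swap₂₃ : ∀ x y z → d ∣ x * y * z → d ∣ x * z * y
  ∣-swap₂₃ x y z = subst (d ∣_) (xy∙z≈xz∙y x y z)

  ∣-rotate : ∀ x y z → d ∣ x * y * z → d ∣ z * x * y
  ∣-rotate x y z h = ∣-swap₁₂ x z y (∣-swap₂₃ x y z h)

  ∣-rotate⁻¹ : ∀ x y z → d ∣ x * y * z → d ∣ y * z * x
  ∣-rotate⁻¹ x y z h = ∣-swap₂₃ y x z (∣-swap₁₂ x y z h)

  ∣*gcd⇒ : ∀ u x y → d ∣ u * gcd x y → ∀ k → d ∣ u * (if k then x else y)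
  ∣*gcd⇒ u x y h k = ∣-trans h (*-monoʳ-∣ u (gcd∣choice k x y))

  ∣*gcd⇐ : ∀ u x y → (∀ k → d ∣ u * (if k then x else y)) → d ∣ u * gcd x y
  ∣*gcd⇐ u x y h =
    subst (d ∣_) (sym (c*gcd[m,n]≡gcd[cm,cn] u x y)) (gcd-greatest (h true) (h false))

  ∣gcd*gcd*⇒ : ∀ x₁ y₁ x₂ y₂ w → d ∣ gcd x₁ y₁ * gcd x₂ y₂ * w →
    ∀ i j → d ∣ (if i then x₁ else y₁) * (if j then x₂ else y₂) * w
  ∣gcd*gcd*⇒ x₁ y₁ x₂ y₂ w h i j =
    ∣-trans h (*-monoˡ-∣ w (*-pres-∣ (gcd∣choice i x₁ y₁) (gcd∣choice j x₂ y₂)))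

  -- Each gcd is moved to the last position in turn and resolved by ∣*gcd⇐:
  -- first g₂ (for each choice c₁ of the first factor), then g₁.
  ∣gcd*gcd*⇐ : ∀ x₁ y₁ x₂ y₂ w →
    (∀ i j → d ∣ (if i then x₁ else y₁) * (if j then x₂ else y₂) * w) →
    d ∣ gcd x₁ y₁ * gcd x₂ y₂ * w
  ∣gcd*gcd*⇐ x₁ y₁ x₂ y₂ w h =
    ∣-rotate g₂ w g₁ (∣*gcd⇐ (g₂ * w) x₁ y₁ λ i → ∣-rotate⁻¹ (c₁ i) g₂ w (secondResolved i))
    where
    g₁ g₂ : ℕ
    g₁ = gcd x₁ y₁
    g₂ = gcd x₂ y₂
    c₁ : Bool → ℕ
    c₁ i = if i then x₁ else y₁
    secondResolved : ∀ i → d ∣ c₁ i * g₂ * w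
    secondResolved i = ∣-swap₂₃ (c₁ i) w g₂ (∣*gcd⇐ (c₁ i * w) x₂ y₂ λ j →
      ∣-swap₂₃ (c₁ i) (if j then x₂ else y₂) w (h i j))

  ∣gcd³⇒ : ∀ x₁ y₁ x₂ y₂ x₃ y₃ → d ∣ gcd x₁ y₁ * gcd x₂ y₂ * gcd x₃ y₃ →
    ∀ i j k → d ∣ (if i then x₁ else y₁) * (if j then x₂ else y₂) * (if k then x₃ else y₃)
  ∣gcd³⇒ x₁ y₁ x₂ y₂ x₃ y₃ h i j k =
    ∣gcd*gcd*⇒ x₁ y₁ x₂ y₂ (if k then x₃ else y₃)
      (∣*gcd⇒ (gcd x₁ y₁ * gcd x₂ y₂) x₃ y₃ h k) i j

  ∣gcd³⇐ : ∀ x₁ y₁ x₂ y₂ x₃ y₃ →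
    (∀ i j k → d ∣ (if i then x₁ else y₁) * (if j then x₂ else y₂) * (if k then x₃ else y₃)) →
    d ∣ gcd x₁ y₁ * gcd x₂ y₂ * gcd x₃ y₃
  ∣gcd³⇐ x₁ y₁ x₂ y₂ x₃ y₃ h =
    ∣*gcd⇐ (gcd x₁ y₁ * gcd x₂ y₂) x₃ y₃ λ k →
      ∣gcd*gcd*⇐ x₁ y₁ x₂ y₂ (if k then x₃ else y₃) (λ i j → h i j k)

  record DividesMixedCubics (m₁ m₂ m₃ : ℕ) : Set where
    field
      ∣m₁²m₂  : d ∣ m₁ * m₁ * m₂
      ∣m₁²m₃  : d ∣ m₁ * m₁ * m₃
      ∣m₁m₂²  : d ∣ m₁ * m₂ * m₂
      ∣m₁m₂m₃ : d ∣ m₁ * m₂ * m₃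
      ∣m₁m₃²  : d ∣ m₁ * m₃ * m₃
      ∣m₂²m₃  : d ∣ m₂ * m₂ * m₃
      ∣m₂m₃²  : d ∣ m₂ * m₃ * m₃

  ∣square⇒ : ∀ x y z → d ∣ gcd x y ^ 2 * z →
    ∀ i j → d ∣ (if i then x else y) * (if j then x else y) * z
  ∣square⇒ x y z h = ∣gcd*gcd*⇒ x y x y z (subst (d ∣_) (square* (gcd x y) z) h)

  ∣square⇐ : ∀ x y z → (∀ i j → d ∣ (if i then x else y) * (if j then x else y) * z) →
    d ∣ gcd x y ^ 2 * z
  ∣square⇐ x y z h = subst (d ∣_) (sym (square* (gcd x y) z)) (∣gcd*gcd*⇐ x y x y z h)

  module _ (m₁ m₂ m₃ : ℕ) where

    lhs rhs : ℕ
    lhs = gcd (gcd (gcd m₁ m₂ ^ 2 * m₃) (gcd m₁ m₃ ^ 2 * m₂)) (gcd m₂ m₃ ^ 2 * m₁)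
    rhs = gcd m₁ m₂ * gcd m₁ m₃ * gcd m₂ m₃

    lhs⇒mixed : d ∣ lhs → DividesMixedCubics m₁ m₂ m₃
    lhs⇒mixed h with ∣gcd⇒ h
    ... | ∣gcd[a²m₃,b²m₂] , c²m₁ with ∣gcd⇒ ∣gcd[a²m₃,b²m₂]
    ... | a²m₃ , b²m₂ = record
      { ∣m₁²m₂  = ∣b²m₂ true true
      ; ∣m₁²m₃  = ∣a²m₃ true true
      ; ∣m₁m₂²  = ∣-rotate m₂ m₂ m₁ (∣c²m₁ true true)
      ; ∣m₁m₂m₃ = ∣a²m₃ true false
      ; ∣m₁m₃²  = ∣-rotate m₃ m₃ m₁ (∣c²m₁ false false)
      ; ∣m₂²m₃  = ∣a²m₃ false false
      ; ∣m₂m₃²  = ∣-rotate m₃ m₃ m₂ (∣b²m₂ false false)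
      }
      where
      ∣a²m₃ : ∀ i j → d ∣ (if i then m₁ else m₂) * (if j then m₁ else m₂) * m₃
      ∣a²m₃ = ∣square⇒ m₁ m₂ m₃ a²m₃
      ∣b²m₂ : ∀ i j → d ∣ (if i then m₁ else m₃) * (if j then m₁ else m₃) * m₂
      ∣b²m₂ = ∣square⇒ m₁ m₃ m₂ b²m₂
      ∣c²m₁ : ∀ i j → d ∣ (if i then m₂ else m₃) * (if j then m₂ else m₃) * m₁
      ∣c²m₁ = ∣square⇒ m₂ m₃ m₁ c²m₁

    mixed⇒lhs : DividesMixedCubics m₁ m₂ m₃ → d ∣ lhs
    mixed⇒lhs p = gcd-greatest
      (gcd-greatest (∣square⇐ m₁ m₂ m₃ ∣a²m₃) (∣square⇐ m₁ m₃ m₂ ∣b²m₂))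
      (∣square⇐ m₂ m₃ m₁ ∣c²m₁)
      where
      open DividesMixedCubics p
      ∣a²m₃ : ∀ i j → d ∣ (if i then m₁ else m₂) * (if j then m₁ else m₂) * m₃
      ∣a²m₃ true  true  = ∣m₁²m₃
      ∣a²m₃ true  false = ∣m₁m₂m₃
      ∣a²m₃ false true  = ∣-swap₁₂ m₁ m₂ m₃ ∣m₁m₂m₃
      ∣a²m₃ false false = ∣m₂²m₃
      ∣b²m₂ : ∀ i j → d ∣ (if i then m₁ else m₃) * (if j then m₁ else m₃) * m₂
      ∣b²m₂ true  true  = ∣m₁²m₂
      ∣b²m₂ true  false = ∣-swap₂₃ m₁ m₂ m₃ ∣m₁m₂m₃
      ∣b²m₂ false true  = ∣-rotate m₁ m₂ m₃ ∣m₁m₂m₃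
      ∣b²m₂ false false = ∣-rotate⁻¹ m₂ m₃ m₃ ∣m₂m₃²
      ∣c²m₁ : ∀ i j → d ∣ (if i then m₂ else m₃) * (if j then m₂ else m₃) * m₁
      ∣c²m₁ true  true  = ∣-rotate⁻¹ m₁ m₂ m₂ ∣m₁m₂²
      ∣c²m₁ true  false = ∣-rotate⁻¹ m₁ m₂ m₃ ∣m₁m₂m₃
      ∣c²m₁ false true  = ∣-swap₂₃ m₃ m₁ m₂ (∣-rotate m₁ m₂ m₃ ∣m₁m₂m₃)
      ∣c²m₁ false false = ∣-rotate⁻¹ m₁ m₃ m₃ ∣m₁m₃²

    rhs⇒mixed : d ∣ rhs → DividesMixedCubics m₁ m₂ m₃
    rhs⇒mixed h = record
      { ∣m₁²m₂  = ∣abc true true true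
      ; ∣m₁²m₃  = ∣abc true true false
      ; ∣m₁m₂²  = ∣-swap₁₂ m₂ m₁ m₂ (∣abc false true true)
      ; ∣m₁m₂m₃ = ∣-swap₂₃ m₁ m₃ m₂ (∣abc true false true)
      ; ∣m₁m₃²  = ∣abc true false false
      ; ∣m₂²m₃  = ∣-swap₂₃ m₂ m₃ m₂ (∣abc false false true)
      ; ∣m₂m₃²  = ∣abc false false false
      }
      where
      ∣abc : ∀ i j k →
        d ∣ (if i then m₁ else m₂) * (if j then m₁ else m₃) * (if k then m₂ else m₃)
      ∣abc = ∣gcd³⇒ m₁ m₂ m₁ m₃ m₂ m₃ h

    mixed⇒rhs : DividesMixedCubics m₁ m₂ m₃ → d ∣ rhs
    mixed⇒rhs p = ∣gcd³⇐ m₁ m₂ m₁ m₃ m₂ m₃ ∣abc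
      where
      open DividesMixedCubics p
      ∣abc : ∀ i j k →
        d ∣ (if i then m₁ else m₂) * (if j then m₁ else m₃) * (if k then m₂ else m₃)
      ∣abc true  true  true  = ∣m₁²m₂
      ∣abc true  true  false = ∣m₁²m₃
      ∣abc true  false true  = ∣-swap₂₃ m₁ m₂ m₃ ∣m₁m₂m₃
      ∣abc true  false false = ∣m₁m₃²
      ∣abc false true  true  = ∣-swap₁₂ m₁ m₂ m₂ ∣m₁m₂²
      ∣abc false true  false = ∣-swap₁₂ m₁ m₂ m₃ ∣m₁m₂m₃
      ∣abc false false true  = ∣-swap₂₃ m₂ m₂ m₃ ∣m₂²m₃
      ∣abc false false false = ∣m₂m₃²

-- Both sides have the same divisors (the common divisors of the mixed
-- cubics), so each divides the other.
lemma6p2 : (m₁ m₂ m₃ : ℕ) → .{{_ : NonZero m₁}} → .{{_ : NonZero m₂}} → .{{_ : NonZero m₃}} →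
    gcd (gcd (gcd m₁ m₂ ^ 2 * m₃) (gcd m₁ m₃ ^ 2 * m₂)) (gcd m₂ m₃ ^ 2 * m₁)
      ≡ gcd m₁ m₂ * gcd m₁ m₃ * gcd m₂ m₃
lemma6p2 m₁ m₂ m₃ = ∣-antisym
  (mixed⇒rhs m₁ m₂ m₃ (lhs⇒mixed m₁ m₂ m₃ ∣-refl))
  (mixed⇒lhs m₁ m₂ m₃ (rhs⇒mixed m₁ m₂ m₃ ∣-refl))
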